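{- Let $S$ be a ring containing an element $s$ such that both $s$ and $s+1$ are nonunits, and let $p\in S$. Then the following are equivalent: (a) $0\in\operatorname{lpow}(p)$; (b) both $p$ and $p-1$ are units; (c) $\operatorname{lpow}(p)=S$.
   Context: All rings are nonzero, commutative and unital. For $p$ in a ring $S$, $\operatorname{lpow}(p)$ is the set of $f\in S$ such that $p\mid f$, $p-1\mid f-1$, and every divisor of $f$ is either a unit or a multiple of $p$. -}

module Defs where

open import Level using (_⊔_)
open import Algebra.Bundles using (CommutativeRing)
open import Data.Product using (Σ; _×_)
open import Data.Sum using (_⊎_)
open import Relation.Nullary using (¬_)

module _ {c ℓ} (R : CommutativeRing c ℓ) where
  open CommutativeRing R

  Divides : Carrier → Carrier → Set (c ⊔ ℓ)
  Divides a b = Σ Carrier (λ q → b ≈ a * q)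

  IsUnit : Carrier → Set (c ⊔ ℓ)
  IsUnit u = Σ Carrier (λ v → u * v ≈ 1#)

  Nontrivial : Set ℓ
  Nontrivial = ¬ (1# ≈ 0#)

  Lpow : Carrier → Carrier → Set (c ⊔ ℓ)
  Lpow p f = Divides p f
           × Divides (p - 1#) (f - 1#)
           × ((d : Carrier) → Divides d f → IsUnit d ⊎ Divides p d)

-- If 0 ∈ lpow(p), every nonunit is a multiple of p (all elements divide 0); the
-- nonunits s and s + 1 then make p divide their difference 1, and p - 1 ∣ 0 - 1
-- makes p - 1 a unit. Conversely, when p and p - 1 are units every divisibility
-- condition in lpow(p) holds trivially, so lpow(p) is the whole ring.
module Submission where

open import Defs
open import Level using (Level)
open import Algebra.Bundles using (CommutativeRing)
open import Data.Product using (Σ; _×_; _,_)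
open import Data.Sum using (inj₁; inj₂)
open import Data.Empty using (⊥-elim)
open import Relation.Nullary using (¬_)
open import Function.Bundles using (_⇔_; mk⇔)
import Algebra.Properties.Ring as RingProperties
import Algebra.Properties.AbelianGroup as AbelianGroupProperties
import Relation.Binary.Reasoning.Setoid as SetoidReasoning

module _ {c ℓ : Level} (S : CommutativeRing c ℓ) where
  open CommutativeRing S
  open RingProperties ring using (-‿distribʳ-*; -‿involutive)
  open AbelianGroupProperties +-abelianGroup using (xyx⁻¹≈y)
  open SetoidReasoning setoid

  unit⇒∣ : ∀ {u} → IsUnit S u → ∀ x → Divides S u x
  unit⇒∣ {u} (v , uv≈1) x = v * x , (begin
    x           ≈⟨ *-identityˡ x ⟨
    1# * x      ≈⟨ *-congʳ uv≈1 ⟨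
    (u * v) * x ≈⟨ *-assoc u v x ⟩
    u * (v * x) ∎)

  ∣0# : ∀ d → Divides S d 0#
  ∣0# d = 0# , sym (zeroʳ d)

  ∣-1#⇒unit : ∀ {d} → Divides S d (- 1#) → IsUnit S d
  ∣-1#⇒unit {d} (q , -1≈dq) = - q , (begin
    d * - q    ≈⟨ -‿distribʳ-* d q ⟨
    - (d * q)  ≈⟨ -‿cong -1≈dq ⟨
    - (- 1#)   ≈⟨ -‿involutive 1# ⟩
    1#         ∎)

  ∣x∧∣x+1#⇒unit : ∀ {d x} → Divides S d x → Divides S d (x + 1#) → IsUnit S d
  ∣x∧∣x+1#⇒unit {d} {x} (a , x≈da) (b , x+1≈db) = b - a , (begin
    d * (b - a)        ≈⟨ distribˡ d b (- a) ⟩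
    d * b + d * - a    ≈⟨ +-congˡ (-‿distribʳ-* d a) ⟨
    d * b - d * a      ≈⟨ +-cong x+1≈db (-‿cong x≈da) ⟨
    (x + 1#) - x       ≈⟨ xyx⁻¹≈y x 1# ⟩
    1#                 ∎)

  0#∈lpow⇒∣nonunit : ∀ {p} → Lpow S p 0# → ∀ {x} → ¬ IsUnit S x → Divides S p x
  0#∈lpow⇒∣nonunit (_ , _ , divisorsOf0) {x} nonunit with divisorsOf0 x (∣0# x)
  ... | inj₁ unit = ⊥-elim (nonunit unit)
  ... | inj₂ p∣x  = p∣x

  0#∈lpow⇒units : Σ Carrier (λ s → ¬ IsUnit S s × ¬ IsUnit S (s + 1#)) →
                  ∀ {p} → Lpow S p 0# → IsUnit S p × IsUnit S (p - 1#)
  0#∈lpow⇒units (s , s-nonunit , s+1-nonunit) 0∈lpow@(_ , (q , 0-1≈[p-1]q) , _) =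
    ∣x∧∣x+1#⇒unit (0#∈lpow⇒∣nonunit 0∈lpow s-nonunit) (0#∈lpow⇒∣nonunit 0∈lpow s+1-nonunit) ,
    ∣-1#⇒unit (q , trans (sym (+-identityˡ (- 1#))) 0-1≈[p-1]q)

  units⇒∈lpow : ∀ {p} → IsUnit S p × IsUnit S (p - 1#) → ∀ f → Lpow S p f
  units⇒∈lpow (p-unit , p-1-unit) f =
    unit⇒∣ p-unit f , unit⇒∣ p-1-unit (f - 1#) , λ d _ → inj₂ (unit⇒∣ p-unit d)

proposition2p3 : ∀ {c ℓ : Level} (S : CommutativeRing c ℓ) →
    let open CommutativeRing S in
    Nontrivial S →
    Σ Carrier (λ s → ¬ IsUnit S s × ¬ IsUnit S (s + 1#)) →
    (p : Carrier) →
    (Lpow S p 0# ⇔ (IsUnit S p × IsUnit S (p - 1#)))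
    × ((IsUnit S p × IsUnit S (p - 1#)) ⇔ ((f : Carrier) → Lpow S p f))
proposition2p3 S _ nonunits _ =
  mk⇔ (0#∈lpow⇒units S nonunits) (λ units → units⇒∈lpow S units 0#) ,
  mk⇔ (units⇒∈lpow S) (λ lpow≡S → 0#∈lpow⇒units S nonunits (lpow≡S 0#))
  where open CommutativeRing S using (0#)
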